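{- Let $N$ be the place-transition net with places $p_1,\dots,p_8$ and transitions $t_1,\dots,t_6$, whose arcs (all of multiplicity $1$ unless stated otherwise) are: $t_1$: input $p_1$; output $p_5$ with multiplicity $2$. $t_2$: inputs $p_4, p_5$; output $p_6$. $t_3$: inputs $p_4, p_5, p_8$; outputs $p_7, p_8$. $t_4$: input $p_6$ with multiplicity $2$; outputs $p_2$ and $p_4$ with multiplicity $2$. $t_5$: inputs $p_5, p_6$; outputs $p_3, p_4$. $t_6$: inputs $p_5, p_7$; outputs $p_3, p_4$. Let $x \geq 1$ be an integer and consider the initial marking $\{p_1, x\cdot p_4, p_8\}$ (one token in $p_1$, $x$ tokens in $p_4$, one token in $p_8$, no other tokens). Run $N$ as a strong Sleptsov net. Then every run of the net from this initial marking terminates (reaches a marking in which no transition is firable), and the terminal marking is $\{p_2, x\cdot p_4, p_8\}$ if $x>1$, and $\{p_3, x\cdot p_4, p_8\}$ if $x=1$. Thus, if a register with nonnegative integer value $v$ is stored in place $p_4$ as the marking $x=v+1$, the net, started by a token in $p_1$, puts a token into $p_3$ exactly when $v=0$ and into $p_2$ exactly when $v>0$, leaving the register unchanged.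
   Context: A place-transition net is $N=(P,T,A,\mu_0)$ with finite place set $P$, finite transition set $T$, arc multiplicities $A: P\times T \cup T\times P \to \mathbb{Z}_{\geq 0}$ (writing $a(p,t)$, $a(t,p)$), and markings $\mu: P\to\mathbb{Z}_{\geq 0}$, $\mu_0$ initial. The firability multiplicity of transition $t$ in marking $\mu$ is $c(t)=\min_{p: a(p,t)>0} \lfloor \mu(p)/a(p,t)\rfloor$; $t$ is firable if $c(t)>0$. In a strong Sleptsov net, at each step one firable transition $t$ whose $c(t)$ is maximal among all transitions is chosen (nondeterministically if several have the same maximal value) and fires $c(t)$ times at once: $\mu'(p)=\mu(p)-c(t)\,a(p,t)+c(t)\,a(t,p)$ for all $p\in P$. The net of the claim is the paper's zero-check net given in a figure; its arcs are as reconstructed from the firing sequences described in the paper's proof. -}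

module Defs where

open import Data.Nat using (ℕ; zero; suc; _+_; _*_; _∸_; _≤_; _<_; _⊔_; _⊓_)
open import Data.Nat.DivMod using (_/_)
open import Data.Fin using (Fin; zero; suc)
open import Data.Vec using (Vec; lookup; tabulate; _∷_; [])
open import Data.List using (List; foldr)
open import Data.List.Base using (allFin)
open import Data.Maybe using (Maybe; just; nothing)
open import Data.Product using (Σ; ∃; _×_; _,_)
open import Relation.Binary.PropositionalEquality using (_≡_)
open import Relation.Binary.Construct.Closure.ReflexiveTransitive using (Star)
open import Induction.WellFounded using (Acc)

-- Places p₁..p₈ are Fin 8 (pᵢ = index i-1), transitions t₁..t₆ are Fin 6.
Place : Set
Place = Fin 8

Transition : Set
Transition = Fin 6

Marking : Set
Marking = Vec ℕ 8

pre : Transition → Vec ℕ 8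
--                    p1 p2 p3 p4 p5 p6 p7 p8
pre zero                 = 1 ∷ 0 ∷ 0 ∷ 0 ∷ 0 ∷ 0 ∷ 0 ∷ 0 ∷ []
pre (suc zero)           = 0 ∷ 0 ∷ 0 ∷ 1 ∷ 1 ∷ 0 ∷ 0 ∷ 0 ∷ []
pre (suc (suc zero))     = 0 ∷ 0 ∷ 0 ∷ 1 ∷ 1 ∷ 0 ∷ 0 ∷ 1 ∷ []
pre (suc (suc (suc zero))) = 0 ∷ 0 ∷ 0 ∷ 0 ∷ 0 ∷ 2 ∷ 0 ∷ 0 ∷ []
pre (suc (suc (suc (suc zero)))) = 0 ∷ 0 ∷ 0 ∷ 0 ∷ 1 ∷ 1 ∷ 0 ∷ 0 ∷ []
pre (suc (suc (suc (suc (suc zero))))) = 0 ∷ 0 ∷ 0 ∷ 0 ∷ 1 ∷ 0 ∷ 1 ∷ 0 ∷ []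

post : Transition → Vec ℕ 8
post zero                 = 0 ∷ 0 ∷ 0 ∷ 0 ∷ 2 ∷ 0 ∷ 0 ∷ 0 ∷ []
post (suc zero)           = 0 ∷ 0 ∷ 0 ∷ 0 ∷ 0 ∷ 1 ∷ 0 ∷ 0 ∷ []
post (suc (suc zero))     = 0 ∷ 0 ∷ 0 ∷ 0 ∷ 0 ∷ 0 ∷ 1 ∷ 1 ∷ []
post (suc (suc (suc zero))) = 0 ∷ 1 ∷ 0 ∷ 2 ∷ 0 ∷ 0 ∷ 0 ∷ 0 ∷ []
post (suc (suc (suc (suc zero)))) = 0 ∷ 0 ∷ 1 ∷ 1 ∷ 0 ∷ 0 ∷ 0 ∷ 0 ∷ []
post (suc (suc (suc (suc (suc zero))))) = 0 ∷ 0 ∷ 1 ∷ 1 ∷ 0 ∷ 0 ∷ 0 ∷ 0 ∷ []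

a-in : Place → Transition → ℕ
a-in p t = lookup (pre t) p

a-out : Transition → Place → ℕ
a-out t p = lookup (post t) p

-- Minimum of two "extended naturals" (nothing = +∞).
minM : Maybe ℕ → Maybe ℕ → Maybe ℕ
minM nothing  m        = m
minM (just a) nothing  = just a
minM (just a) (just b) = just (a ⊓ b)

quot : ℕ → ℕ → Maybe ℕ
quot m zero    = nothing
quot m (suc k) = just (m / suc k)

-- Firability multiplicity c(t) = min_{p : a(p,t)>0} ⌊μ(p)/a(p,t)⌋
-- (nothing would mean +∞, i.e. t has no input place; this never happens in this net).
c : Marking → Transition → Maybe ℕ
c μ t = foldr (λ p r → minM (quot (lookup μ p) (a-in p t)) r) nothing (allFin 8)

fire : Marking → Transition → ℕ → Marking
fire μ t k = tabulate (λ p → (lookup μ p ∸ k * a-in p t) + k * a-out t p)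

Step : Marking → Marking → Set
Step μ μ' = Σ Transition λ t → Σ ℕ λ k →
  (c μ t ≡ just k) × (0 < k) ×
  (∀ t' k' → c μ t' ≡ just k' → k' ≤ k) ×
  (μ' ≡ fire μ t k)

Dead : Marking → Set
Dead μ = ∀ t k → c μ t ≡ just k → k ≡ 0

Reachable : Marking → Marking → Set
Reachable = Star Step

-- Every run from μ terminates: there is no infinite sequence of steps from μ.
Terminates : Marking → Set
Terminates = Acc (λ μ' μ → Step μ μ')

initial : ℕ → Marking
initial x = 1 ∷ 0 ∷ 0 ∷ x ∷ 0 ∷ 0 ∷ 0 ∷ 1 ∷ []

final : ℕ → Marking
final (suc (suc n)) = 0 ∷ 1 ∷ 0 ∷ suc (suc n) ∷ 0 ∷ 0 ∷ 0 ∷ 1 ∷ []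
final x             = 0 ∷ 0 ∷ 1 ∷ x ∷ 0 ∷ 0 ∷ 0 ∷ 1 ∷ []

-- The token in p₁ becomes two tokens in p₅ (t₁), which lets t₂ borrow min(x, 2) tokens
-- of the register p₄ into p₆.  If x ≥ 2, t₂ fires twice at once and so beats t₃, whose
-- multiplicity is capped at 1 by the single token in p₈; then t₄ returns both tokens to
-- p₄ and signals p₂.  If x = 1, t₂ and t₃ tie at multiplicity 1; either way one token is
-- left in p₅ and t₅ or t₆ returns the borrowed token and signals p₃.  So every run is one
-- of at most two explicit finite paths, each ending in the claimed dead marking.
module Submission where

open import Defs
open import Data.Nat using (ℕ; zero; suc; _≤_; _<_; _⊓_; _/_; z<s)
open import Data.Nat.Properties using (⊓-comm; +-identityʳ; +-comm; 1+n≰n; n≮n)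
open import Data.Nat.DivMod using (n/1≡n)
open import Data.Fin using (zero; suc)
open import Data.Vec using (_∷_; [])
open import Data.Maybe using (just)
open import Data.Maybe.Properties using (just-injective)
open import Data.Product using (Σ; _×_; _,_; proj₁; proj₂)
open import Data.Sum using (_⊎_; inj₁; inj₂; [_,_])
open import Data.Empty using (⊥-elim)
open import Relation.Nullary using (¬_; contradiction)
open import Relation.Binary.PropositionalEquality using (_≡_; refl; sym; trans; cong; cong₂; subst)
open import Relation.Binary.Construct.Closure.ReflexiveTransitive using (ε; _◅_)
open import Induction.WellFounded using (acc)

pattern t₁ = zero
pattern t₂ = suc zero
pattern t₃ = suc (suc zero)
pattern t₄ = suc (suc (suc zero))
pattern t₅ = suc (suc (suc (suc zero)))
pattern t₆ = suc (suc (suc (suc (suc zero))))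

-- The register place p₄ comes last in each minimum, so that the value computes when p₄
-- holds a symbolic number of tokens.
firability : Marking → Transition → ℕ
firability (m₁ ∷ m₂ ∷ m₃ ∷ m₄ ∷ m₅ ∷ m₆ ∷ m₇ ∷ m₈ ∷ []) t₁ = m₁
firability (m₁ ∷ m₂ ∷ m₃ ∷ m₄ ∷ m₅ ∷ m₆ ∷ m₇ ∷ m₈ ∷ []) t₂ = m₅ ⊓ m₄
firability (m₁ ∷ m₂ ∷ m₃ ∷ m₄ ∷ m₅ ∷ m₆ ∷ m₇ ∷ m₈ ∷ []) t₃ = m₅ ⊓ m₈ ⊓ m₄
firability (m₁ ∷ m₂ ∷ m₃ ∷ m₄ ∷ m₅ ∷ m₆ ∷ m₇ ∷ m₈ ∷ []) t₄ = m₆ / 2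
firability (m₁ ∷ m₂ ∷ m₃ ∷ m₄ ∷ m₅ ∷ m₆ ∷ m₇ ∷ m₈ ∷ []) t₅ = m₅ ⊓ m₆
firability (m₁ ∷ m₂ ∷ m₃ ∷ m₄ ∷ m₅ ∷ m₆ ∷ m₇ ∷ m₈ ∷ []) t₆ = m₅ ⊓ m₇

c≡firability : ∀ μ t → c μ t ≡ just (firability μ t)
c≡firability (m₁ ∷ m₂ ∷ m₃ ∷ m₄ ∷ m₅ ∷ m₆ ∷ m₇ ∷ m₈ ∷ []) t₁ = cong just (n/1≡n m₁)
c≡firability (m₁ ∷ m₂ ∷ m₃ ∷ m₄ ∷ m₅ ∷ m₆ ∷ m₇ ∷ m₈ ∷ []) t₂ =
  cong just (trans (cong₂ _⊓_ (n/1≡n m₄) (n/1≡n m₅)) (⊓-comm m₄ m₅))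
c≡firability (m₁ ∷ m₂ ∷ m₃ ∷ m₄ ∷ m₅ ∷ m₆ ∷ m₇ ∷ m₈ ∷ []) t₃ =
  cong just (trans (cong₂ _⊓_ (n/1≡n m₄) (cong₂ _⊓_ (n/1≡n m₅) (n/1≡n m₈)))
                   (⊓-comm m₄ (m₅ ⊓ m₈)))
c≡firability (m₁ ∷ m₂ ∷ m₃ ∷ m₄ ∷ m₅ ∷ m₆ ∷ m₇ ∷ m₈ ∷ []) t₄ = refl
c≡firability (m₁ ∷ m₂ ∷ m₃ ∷ m₄ ∷ m₅ ∷ m₆ ∷ m₇ ∷ m₈ ∷ []) t₅ =
  cong just (cong₂ _⊓_ (n/1≡n m₅) (n/1≡n m₆))
c≡firability (m₁ ∷ m₂ ∷ m₃ ∷ m₄ ∷ m₅ ∷ m₆ ∷ m₇ ∷ m₈ ∷ []) t₆ =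
  cong just (cong₂ _⊓_ (n/1≡n m₅) (n/1≡n m₇))

c≡just⇒firability : ∀ μ t {k} → c μ t ≡ just k → k ≡ firability μ t
c≡just⇒firability μ t cμt≡k = just-injective (trans (sym cμt≡k) (c≡firability μ t))

enabled⇒¬Dead : ∀ μ t → 0 < firability μ t → ¬ Dead μ
enabled⇒¬Dead μ t 0<k dead = n≮n 0 (subst (0 <_) (dead t _ (c≡firability μ t)) 0<k)

disabled⇒Dead : ∀ μ → (∀ t → firability μ t ≡ 0) → Dead μ
disabled⇒Dead μ disabled t k cμt≡k = trans (c≡just⇒firability μ t cμt≡k) (disabled t)

Dead⇒¬Step : ∀ σ {μ} → Dead σ → ¬ Step σ μ
Dead⇒¬Step σ dead (t , k , cσt≡k , 0<k , _) = n≮n 0 (subst (0 <_) (dead t k cσt≡k) 0<k)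

MaximalFiring : Marking → Transition → Marking → Set
MaximalFiring σ t μ =
  0 < firability σ t × (∀ t′ → firability σ t′ ≤ firability σ t) × μ ≡ fire σ t (firability σ t)

step⇒maximalFiring : ∀ σ {μ} → Step σ μ → Σ Transition λ t → MaximalFiring σ t μ
step⇒maximalFiring σ (t , k , cσt≡k , 0<k , maximal , μ≡)
  with c≡just⇒firability σ t cσt≡k
... | refl = t , 0<k , (λ t′ → maximal t′ (firability σ t′) (c≡firability σ t′)) , μ≡

infix 4 _⇓_

_⇓_ : Marking → Marking → Set
σ ⇓ F = Terminates σ × (∀ μ → Reachable σ μ → Dead μ → μ ≡ F)

dead⇒⇓ : ∀ {F} → Dead F → F ⇓ F
dead⇒⇓ {F} dead = acc (λ s → ⊥-elim (Dead⇒¬Step F dead s)) , λ where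
  _ ε _ → refl
  _ (s ◅ _) _ → ⊥-elim (Dead⇒¬Step F dead s)

⇓-backward : ∀ {σ F} → ¬ Dead σ → (∀ {μ} → Step σ μ → μ ⇓ F) → σ ⇓ F
⇓-backward live next = acc (λ s → proj₁ (next s)) , λ where
  _ ε dead → ⊥-elim (live dead)
  μ (s ◅ ss) dead → proj₂ (next s) μ ss dead

⇓-deterministic : ∀ {σ τ F} → ¬ Dead σ → (∀ {μ} → Step σ μ → μ ≡ τ) → τ ⇓ F → σ ⇓ F
⇓-deterministic {F = F} live next τ⇓F =
  ⇓-backward live (λ s → subst (_⇓ F) (sym (next s)) τ⇓F)

doubled : ℕ → Marking
doubled x = 0 ∷ 0 ∷ 0 ∷ x ∷ 2 ∷ 0 ∷ 0 ∷ 1 ∷ []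

borrowed₂ : ℕ → Marking
borrowed₂ n = 0 ∷ 0 ∷ 0 ∷ n ∷ 0 ∷ 2 ∷ 0 ∷ 1 ∷ []

borrowed₁ flagged : Marking
borrowed₁ = 0 ∷ 0 ∷ 0 ∷ 0 ∷ 1 ∷ 1 ∷ 0 ∷ 1 ∷ []
flagged   = 0 ∷ 0 ∷ 0 ∷ 0 ∷ 1 ∷ 0 ∷ 1 ∷ 1 ∷ []

Dead-final : ∀ x → Dead (final x)
Dead-final zero = disabled⇒Dead (final 0)
  λ { t₁ → refl ; t₂ → refl ; t₃ → refl ; t₄ → refl ; t₅ → refl ; t₆ → refl }
Dead-final (suc zero) = disabled⇒Dead (final 1)
  λ { t₁ → refl ; t₂ → refl ; t₃ → refl ; t₄ → refl ; t₅ → refl ; t₆ → refl }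
Dead-final (suc (suc n)) = disabled⇒Dead (final (suc (suc n)))
  λ { t₁ → refl ; t₂ → refl ; t₃ → refl ; t₄ → refl ; t₅ → refl ; t₆ → refl }

initial⟶doubled : ∀ x {μ} → Step (initial x) μ → μ ≡ doubled x
initial⟶doubled x s with step⇒maximalFiring (initial x) s
... | t₁ , _ , _ , μ≡ = trans μ≡ (cong doubled (+-identityʳ x))
... | t₂ , () , _
... | t₃ , () , _
... | t₄ , () , _
... | t₅ , () , _
... | t₆ , () , _

doubled⟶borrowed₂ : ∀ n {μ} → Step (doubled (suc (suc n))) μ → μ ≡ borrowed₂ n
doubled⟶borrowed₂ n s with step⇒maximalFiring (doubled (suc (suc n))) s
... | t₁ , () , _
... | t₂ , _ , _ , μ≡ = trans μ≡ (cong borrowed₂ (+-identityʳ n))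
-- t₃ is enabled too, but with multiplicity 1 < 2.
... | t₃ , _ , maximal , _ = contradiction (maximal t₂) 1+n≰n
... | t₄ , () , _
... | t₅ , () , _
... | t₆ , () , _

borrowed₂⟶final : ∀ n {μ} → Step (borrowed₂ n) μ → μ ≡ final (suc (suc n))
borrowed₂⟶final n s with step⇒maximalFiring (borrowed₂ n) s
... | t₁ , () , _
... | t₂ , () , _
... | t₃ , () , _
... | t₄ , _ , _ , μ≡ = trans μ≡ (cong (λ r → 0 ∷ 1 ∷ 0 ∷ r ∷ 0 ∷ 0 ∷ 0 ∷ 1 ∷ []) (+-comm n 2))
... | t₅ , () , _
... | t₆ , () , _

doubled⟶borrowed₁⊎flagged : ∀ {μ} → Step (doubled 1) μ → μ ≡ borrowed₁ ⊎ μ ≡ flagged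
doubled⟶borrowed₁⊎flagged s with step⇒maximalFiring (doubled 1) s
... | t₁ , () , _
... | t₂ , _ , _ , μ≡ = inj₁ μ≡
... | t₃ , _ , _ , μ≡ = inj₂ μ≡
... | t₄ , () , _
... | t₅ , () , _
... | t₆ , () , _

borrowed₁⟶final : ∀ {μ} → Step borrowed₁ μ → μ ≡ final 1
borrowed₁⟶final s with step⇒maximalFiring borrowed₁ s
... | t₁ , () , _
... | t₂ , () , _
... | t₃ , () , _
... | t₄ , () , _
... | t₅ , _ , _ , μ≡ = μ≡
... | t₆ , () , _

flagged⟶final : ∀ {μ} → Step flagged μ → μ ≡ final 1
flagged⟶final s with step⇒maximalFiring flagged s
... | t₁ , () , _
... | t₂ , () , _
... | t₃ , () , _
... | t₄ , () , _
... | t₅ , () , _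
... | t₆ , _ , _ , μ≡ = μ≡

doubled⇓final : ∀ x → 1 ≤ x → doubled x ⇓ final x
doubled⇓final (suc zero) _ =
  ⇓-backward (enabled⇒¬Dead (doubled 1) t₂ z<s)
    (λ s → [ (λ μ≡ → subst (_⇓ final 1) (sym μ≡) borrowed₁⇓final)
           , (λ μ≡ → subst (_⇓ final 1) (sym μ≡) flagged⇓final)
           ] (doubled⟶borrowed₁⊎flagged s))
  where
  borrowed₁⇓final : borrowed₁ ⇓ final 1
  borrowed₁⇓final =
    ⇓-deterministic (enabled⇒¬Dead borrowed₁ t₅ z<s) borrowed₁⟶final (dead⇒⇓ (Dead-final 1))
  flagged⇓final : flagged ⇓ final 1
  flagged⇓final =
    ⇓-deterministic (enabled⇒¬Dead flagged t₆ z<s) flagged⟶final (dead⇒⇓ (Dead-final 1))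
doubled⇓final (suc (suc n)) _ =
  ⇓-deterministic (enabled⇒¬Dead (doubled (suc (suc n))) t₂ z<s) (doubled⟶borrowed₂ n)
    (⇓-deterministic (enabled⇒¬Dead (borrowed₂ n) t₄ z<s) (borrowed₂⟶final n)
      (dead⇒⇓ (Dead-final (suc (suc n)))))

theorem1 : (x : ℕ) → 1 ≤ x →
    Terminates (initial x) ×
    (∀ μ → Reachable (initial x) μ → Dead μ → μ ≡ final x)
theorem1 x 1≤x =
  ⇓-deterministic (enabled⇒¬Dead (initial x) t₁ z<s) (initial⟶doubled x) (doubled⇓final x 1≤x)
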